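{- Let $m\ge 0$ and $n\ge m+3$. If $D^{sc}_f(Q_{n-1};Q_m)\le n$, then for every family $\mathcal{F}$ of at most $n-m-3$ pairwise disjoint vertex sets of $Q_{n-1}$, each a $k$-subcube of $Q_{n-1}$ for some $0\le k\le m$, the graph $Q_{n-1}-\bigcup\mathcal{F}$ has diameter at most $n-1$.
   Context: The $n$-dimensional hypercube $Q_n$ is the graph whose vertices are the binary strings of length $n$, two vertices being adjacent iff they differ in exactly one position; $Q_0$ is a single vertex. The diameter of a graph is the maximum graph distance between two of its vertices. For $0\le k\le n$, a $k$-subcube of $Q_n$ is a vertex set $U\subseteq V(Q_n)$ whose induced subgraph is isomorphic to $Q_k$. $\kappa^{sc}(Q_n;Q_m)$ is the minimum number of pairwise disjoint vertex sets, each a $k$-subcube of $Q_n$ for some $0\le k\le m$, whose deletion disconnects $Q_n$. $D^{sc}_f(Q_n;Q_m)$ is the maximum diameter of $Q_n-\bigcup\mathcal{F}$ over all families $\mathcal{F}$ of at most $\kappa^{sc}(Q_n;Q_m)-1$ pairwise disjoint vertex sets, each a $k$-subcube of $Q_n$ for some $0\le k\le m$. -}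

module Defs where

open import Data.Nat using (ℕ; zero; suc; _+_; _<_; _≤_)
open import Data.Bool using (Bool; true; false; _≟_)
open import Data.Vec using (Vec; []; _∷_)
open import Data.Fin using (Fin)
open import Data.Product using (Σ; ∃; _×_; _,_)
open import Relation.Nullary using (¬_; yes; no)
open import Relation.Binary.PropositionalEquality using (_≡_; _≢_)
open import Function.Bundles using (_⇔_)
open import Level using (0ℓ)
open import Relation.Unary using (Pred)

V : ℕ → Set
V N = Vec Bool N

hamming : ∀ {N} → V N → V N → ℕ
hamming [] [] = 0
hamming (a ∷ x) (b ∷ y) with a ≟ b
... | yes _ = hamming x y
... | no  _ = suc (hamming x y)

Adj : ∀ N → V N → V N → Set
Adj N x y = hamming x y ≡ 1

VSet : ℕ → Set₁
VSet N = Pred (V N) 0ℓ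

-- U is a k-subcube of Q_N: the subgraph of Q_N induced by U is isomorphic
-- to Q_k, i.e. there is an injective map f : V(Q_k) → V(Q_N) with image
-- exactly U which preserves and reflects adjacency.
IsSubcube : ∀ N k → VSet N → Set
IsSubcube N k U =
  Σ (V k → V N) λ f →
      (∀ y z → f y ≡ f z → y ≡ z)
    × (∀ x → U x ⇔ (∃ λ y → f y ≡ x))
    × (∀ y z → Adj k y z ⇔ Adj N (f y) (f z))

ValidFamily : ∀ N m t → (Fin t → VSet N) → Set
ValidFamily N m t A =
    (∀ i j → i ≢ j → ∀ x → ¬ (A i x × A j x))
  × (∀ i → ∃ λ k → k ≤ m × IsSubcube N k (A i))

Alive : ∀ {N t} → (Fin t → VSet N) → V N → Set
Alive {t = t} A x = ¬ (∃ λ (i : Fin t) → A i x)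

data Walk {N t} (A : Fin t → VSet N) : V N → V N → ℕ → Set where
  here : ∀ {u} → Alive A u → Walk A u u 0
  step : ∀ {u w v ℓ} → Alive A u → Adj N u w → Walk A w v ℓ → Walk A u v (suc ℓ)

Disconnects : ∀ N {t} → (Fin t → VSet N) → Set
Disconnects N A =
  ∃ λ u → ∃ λ v → Alive A u × Alive A v × ¬ (∃ λ ℓ → Walk A u v ℓ)

-- diam(Q_N − ⋃ A) ≤ d  (a disconnected graph has infinite diameter).
DiamLe : ∀ N {t} → (Fin t → VSet N) → ℕ → Set
DiamLe N A d =
  ∀ u v → Alive A u → Alive A v → ∃ λ ℓ → ℓ ≤ d × Walk A u v ℓ

-- t ≤ κ^{sc}(Q_N;Q_m) − 1, i.e. t < κ^{sc}(Q_N;Q_m) = min size of a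
-- disconnecting valid family.
BelowKappa : ℕ → ℕ → ℕ → Set₁
BelowKappa N m t =
  ∀ s (B : Fin s → VSet N) → ValidFamily N m s B → Disconnects N B → t < s

-- D^{sc}_f(Q_N;Q_m) ≤ d : every valid family of size ≤ κ − 1 leaves a graph
-- of diameter ≤ d.
DscfLe : ℕ → ℕ → ℕ → Set₁
DscfLe N m d =
  ∀ t (A : Fin t → VSet N) → ValidFamily N m t A → BelowKappa N m t → DiamLe N A d

-- A k-subcube of Q_N is a face: an injective adjacency-preserving map Q_k → Q_N sends the unit
-- vectors to neighbours of f 0 along k distinct axes, and, since two vertices at distance two have
-- only two common neighbours, induction on the weight shows that f is the affine map spreading y
-- along these axes. So, with N = n − 1, the t ≤ N − m − 2 faults are faces of codimension at least
-- t + 2.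
--
-- Walks are routed inside a face S, starting from the whole cube, under the invariant that every
-- fault meeting S has codimension in S at least j plus the number of faults meeting S. With j = 1,
-- two live vertices differing in every free coordinate of S are joined by a live walk of length
-- dim S: pigeonhole gives a live first step towards v whose coordinate can then be fixed, cutting
-- off a fault so that the invariant survives. With j = 2, any two live vertices of S are joined
-- within dim S steps: fix a free coordinate on which they agree; this keeps j = 2 unless some fault
-- meeting S is fixed there to their common value and none to the opposite one, and then both ends
-- step across that coordinate, where j rises to 3, and a second agreeing coordinate is fixed to pay
-- for the two extra steps.

module Submission where

open import Defs
open import Data.Nat using (ℕ; zero; suc; _+_; _∸_; _≤_; _<_; z≤n; s≤s)
open import Data.Nat.Properties
open import Data.Bool using (Bool; true; false; not; _xor_) renaming (_≟_ to _≟ᵇ_)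
open import Data.Bool.Properties using (not-involutive; not-¬; ¬-not; not-distribʳ-xor; xor-identityʳ; xor-assoc; xor-same)
open import Data.Maybe using (Maybe; just; nothing)
open import Data.Maybe.Properties using (≡-dec)
open import Data.Fin using (Fin; zero; suc)
open import Data.Fin.Properties using (any?; all?; ¬∀⟶∃¬) renaming (_≟_ to _≟ᶠ_; suc-injective to suc-injectiveᶠ)
open import Data.Vec using ([]; _∷_; lookup; tabulate; updateAt; replicate)
open import Data.Vec.Properties
  using (lookup∘updateAt; lookup∘updateAt′; updateAt-updateAt; updateAt-id-local; updateAt-commutes;
         lookup∘tabulate; tabulate∘lookup; tabulate-cong; lookup-replicate)
import Data.Vec.Functional as Vector
import Data.Vec.Functional.Properties as Vector
open import Data.Product using (Σ; ∃; ∃₂; _×_; _,_; proj₁; proj₂)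
open import Data.Sum using (_⊎_; inj₁; inj₂)
open import Data.Unit using (⊤; tt)
open import Function using (_∘_; _$_; const; case_of_)
open import Function.Bundles using (_⇔_; mk⇔; Equivalence)
open import Relation.Nullary using (¬_; Dec; yes; no; contradiction; ¬?)
open import Relation.Nullary.Decidable using (_×-dec_; map′)
open import Relation.Unary using (Pred; Decidable; _⊆_)
open import Relation.Binary.PropositionalEquality
open import Level using (Level)

private variable
  n : ℕ
  ℓ ℓ₁ ℓ₂ : Level


toggle : V n → Fin n → V n
toggle x c = updateAt x c not

lookup-toggle : (x : V n) (c : Fin n) → lookup (toggle x c) c ≡ not (lookup x c)
lookup-toggle x c = lookup∘updateAt c x

lookup-toggle-≢ : (x : V n) {c d : Fin n} → d ≢ c → lookup (toggle x c) d ≡ lookup x d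
lookup-toggle-≢ x {c} {d} d≢c = lookup∘updateAt′ d c d≢c x

toggle-involutive : (x : V n) (c : Fin n) → toggle (toggle x c) c ≡ x
toggle-involutive x c = trans (updateAt-updateAt c x) (updateAt-id-local c x (not-involutive _))

toggle-comm : (x : V n) {c d : Fin n} → c ≢ d → toggle (toggle x c) d ≡ toggle (toggle x d) c
toggle-comm x {c} {d} c≢d = updateAt-commutes d c (c≢d ∘ sym) x

lookup-ext : {x y : V n} → (∀ c → lookup x c ≡ lookup y c) → x ≡ y
lookup-ext {x = x} {y} eq = begin
  x                   ≡⟨ tabulate∘lookup x ⟨
  tabulate (lookup x) ≡⟨ tabulate-cong eq ⟩
  tabulate (lookup y) ≡⟨ tabulate∘lookup y ⟩
  y                   ∎
  where open ≡-Reasoning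

hamming-refl : (x : V n) → hamming x x ≡ 0
hamming-refl []      = refl
hamming-refl (a ∷ x) with a ≟ᵇ a
... | yes _   = hamming-refl x
... | no  a≢a = contradiction refl a≢a

hamming≡0⇒≡ : (x y : V n) → hamming x y ≡ 0 → x ≡ y
hamming≡0⇒≡ []      []      _ = refl
hamming≡0⇒≡ (a ∷ x) (b ∷ y) h with a ≟ᵇ b
... | yes refl = cong (a ∷_) (hamming≡0⇒≡ x y h)

adjacent-toggle : (x : V n) (c : Fin n) → Adj n x (toggle x c)
adjacent-toggle (a ∷ x) zero with a ≟ᵇ not a
... | yes a≡¬a = contradiction a≡¬a (not-¬ refl)
... | no  _    = cong suc (hamming-refl x)
adjacent-toggle (a ∷ x) (suc c) with a ≟ᵇ a
... | yes _   = adjacent-toggle x c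
... | no  a≢a = contradiction refl a≢a

adjacent⇒toggle : (x y : V n) → Adj n x y → ∃ λ c → y ≡ toggle x c
adjacent⇒toggle []      []      ()
adjacent⇒toggle (a ∷ x) (b ∷ y) h with a ≟ᵇ b
... | yes refl = let c , y≡ = adjacent⇒toggle x y h in suc c , cong (a ∷_) y≡
... | no  a≢b  = zero , cong₂ _∷_ (¬-not (a≢b ∘ sym)) (sym (hamming≡0⇒≡ x y (suc-injective h)))

common-neighbour : (p z : V n) {a b : Fin n} → a ≢ b →
  Adj n z (toggle p a) → Adj n z (toggle p b) → z ≡ p ⊎ z ≡ toggle (toggle p a) b
common-neighbour p z {a} {b} a≢b za zb
  with adjacent⇒toggle z (toggle p a) za | adjacent⇒toggle z (toggle p b) zb
... | c , pa≡ | d , pb≡ = classify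
  where
  open ≡-Reasoning
  z≡pac : z ≡ toggle (toggle p a) c
  z≡pac = trans (sym (toggle-involutive z c)) (cong (λ w → toggle w c) (sym pa≡))
  z≡pbd : z ≡ toggle (toggle p b) d
  z≡pbd = trans (sym (toggle-involutive z d)) (cong (λ w → toggle w d) (sym pb≡))
  pac≡pbd : toggle (toggle p a) c ≡ toggle (toggle p b) d
  pac≡pbd = trans (sym z≡pac) z≡pbd
  classify : z ≡ p ⊎ z ≡ toggle (toggle p a) b
  classify with c ≟ᶠ a | c ≟ᶠ b | d ≟ᶠ a
  ... | yes refl | _ | _ = inj₁ (trans z≡pac (toggle-involutive p a))
  ... | no _ | yes refl | _ = inj₂ z≡pac
  ... | no c≢a | no c≢b | no d≢a = contradiction (begin
        lookup p a                          ≡⟨ lookup-toggle-≢ p a≢b ⟨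
        lookup (toggle p b) a               ≡⟨ lookup-toggle-≢ (toggle p b) (d≢a ∘ sym) ⟨
        lookup (toggle (toggle p b) d) a    ≡⟨ cong (λ w → lookup w a) pac≡pbd ⟨
        lookup (toggle (toggle p a) c) a    ≡⟨ lookup-toggle-≢ (toggle p a) (c≢a ∘ sym) ⟩
        lookup (toggle p a) a               ≡⟨ lookup-toggle p a ⟩
        not (lookup p a)                    ∎) (not-¬ refl)
  ... | no c≢a | no c≢b | yes refl = contradiction (begin
        lookup p c                          ≡⟨ lookup-toggle-≢ p c≢b ⟨
        lookup (toggle p b) c               ≡⟨ lookup-toggle-≢ (toggle p b) c≢a ⟨
        lookup (toggle (toggle p b) d) c    ≡⟨ cong (λ w → lookup w c) pac≡pbd ⟨
        lookup (toggle (toggle p a) c) c    ≡⟨ lookup-toggle (toggle p a) c ⟩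
        not (lookup (toggle p a) c)         ≡⟨ cong not (lookup-toggle-≢ p c≢a) ⟩
        not (lookup p c)                    ∎) (not-¬ refl)

walk-snoc : ∀ {N t} {A : Fin t → VSet N} {u w v : V N} {ℓ : ℕ} →
  Walk A u w ℓ → Adj N w v → Alive A v → Walk A u v (suc ℓ)
walk-snoc (here alive-u) u~v alive-v        = step alive-u u~v (here alive-v)
walk-snoc (step alive-u u~w walk) w~v alive-v = step alive-u u~w (walk-snoc walk w~v alive-v)

module _ {N t} {A B : Fin t → VSet N} (B⊆A : ∀ i x → B i x → A i x) where

  alive-resp : {x : V N} → Alive A x → Alive B x
  alive-resp alive (i , Bx) = alive (i , B⊆A i _ Bx)

  walk-resp : {u v : V N} {ℓ : ℕ} → Walk A u v ℓ → Walk B u v ℓ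
  walk-resp (here alive)          = here (alive-resp alive)
  walk-resp (step alive u~w walk) = step (alive-resp alive) u~w (walk-resp walk)

DiamLe-resp : ∀ {N t d} {A B : Fin t → VSet N} → (∀ i x → A i x ⇔ B i x) → DiamLe N A d → DiamLe N B d
DiamLe-resp {A = A} {B} A⇔B diam u v alive-u alive-v =
  let ℓ , ℓ≤d , walk = diam u v (alive-resp A⊆B alive-u) (alive-resp A⊆B alive-v)
  in ℓ , ℓ≤d , walk-resp B⊆A walk
  where
  A⊆B : ∀ i x → A i x → B i x
  A⊆B i x = Equivalence.to (A⇔B i x)
  B⊆A : ∀ i x → B i x → A i x
  B⊆A i x = Equivalence.from (A⇔B i x)

-- Counting decidable sets of indices

count : {P : Pred (Fin n) ℓ} → Decidable P → ℕ
count {n = zero}  P? = 0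
count {n = suc n} P? with P? zero
... | yes _ = suc (count (P? ∘ suc))
... | no  _ = count (P? ∘ suc)

_∖_ : {P : Pred (Fin n) ℓ} → Decidable P → (e : Fin n) → Decidable (λ c → P c × c ≢ e)
(P? ∖ e) c = P? c ×-dec ¬? (c ≟ᶠ e)

count-mono : {P : Pred (Fin n) ℓ₁} {Q : Pred (Fin n) ℓ₂} (P? : Decidable P) (Q? : Decidable Q) →
  P ⊆ Q → count P? ≤ count Q?
count-mono {n = zero}  P? Q? P⊆Q = z≤n
count-mono {n = suc n} P? Q? P⊆Q with P? zero | Q? zero
... | yes p | no ¬q = contradiction (P⊆Q p) ¬q
... | yes _ | yes _ = s≤s (count-mono (P? ∘ suc) (Q? ∘ suc) P⊆Q)
... | no _  | yes _ = m≤n⇒m≤1+n (count-mono (P? ∘ suc) (Q? ∘ suc) P⊆Q)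
... | no _  | no _  = count-mono (P? ∘ suc) (Q? ∘ suc) P⊆Q

count-≐ : {P : Pred (Fin n) ℓ₁} {Q : Pred (Fin n) ℓ₂} (P? : Decidable P) (Q? : Decidable Q) →
  P ⊆ Q → Q ⊆ P → count P? ≡ count Q?
count-≐ P? Q? P⊆Q Q⊆P = ≤-antisym (count-mono P? Q? P⊆Q) (count-mono Q? P? Q⊆P)

count≤n : {P : Pred (Fin n) ℓ} (P? : Decidable P) → count P? ≤ n
count≤n {n = zero}  P? = z≤n
count≤n {n = suc n} P? with P? zero
... | yes _ = s≤s (count≤n (P? ∘ suc))
... | no  _ = m≤n⇒m≤1+n (count≤n (P? ∘ suc))

count-∅ : {P : Pred (Fin n) ℓ} (P? : Decidable P) → (∀ c → ¬ P c) → count P? ≡ 0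
count-∅ {n = zero}  P? ∅ = refl
count-∅ {n = suc n} P? ∅ with P? zero
... | yes p = contradiction p (∅ zero)
... | no  _ = count-∅ (P? ∘ suc) (∅ ∘ suc)

count≡0⇒∅ : {P : Pred (Fin n) ℓ} (P? : Decidable P) → count P? ≡ 0 → ∀ c → ¬ P c
count≡0⇒∅ {n = suc n} P? none c p with P? zero
count≡0⇒∅ {n = suc n} P? none zero    p | no ¬p = ¬p p
count≡0⇒∅ {n = suc n} P? none (suc c) p | no _  = count≡0⇒∅ (P? ∘ suc) none c p

count>0⇒∃ : {P : Pred (Fin n) ℓ} (P? : Decidable P) → 0 < count P? → ∃ P
count>0⇒∃ {n = suc n} P? pos with P? zero
... | yes p = zero , p
... | no  _ = let c , p = count>0⇒∃ (P? ∘ suc) pos in suc c , p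

count-< : {P : Pred (Fin n) ℓ₁} {Q : Pred (Fin n) ℓ₂} (P? : Decidable P) (Q? : Decidable Q) {e : Fin n} →
  P ⊆ Q → ¬ P e → Q e → count P? < count Q?
count-< P? Q? {zero} P⊆Q ¬pe qe with P? zero | Q? zero
... | yes p | _     = contradiction p ¬pe
... | no _  | no ¬q = contradiction qe ¬q
... | no _  | yes _ = s≤s (count-mono (P? ∘ suc) (Q? ∘ suc) P⊆Q)
count-< P? Q? {suc e} P⊆Q ¬pe qe with P? zero | Q? zero
... | yes p | no ¬q = contradiction (P⊆Q p) ¬q
... | yes _ | yes _ = s≤s (count-< (P? ∘ suc) (Q? ∘ suc) P⊆Q ¬pe qe)
... | no _  | yes _ = m≤n⇒m≤1+n (count-< (P? ∘ suc) (Q? ∘ suc) P⊆Q ¬pe qe)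
... | no _  | no _  = count-< (P? ∘ suc) (Q? ∘ suc) P⊆Q ¬pe qe

count≤1+ : {P : Pred (Fin n) ℓ₁} {Q : Pred (Fin n) ℓ₂} (P? : Decidable P) (Q? : Decidable Q) (e : Fin n) →
  (∀ {c} → c ≢ e → P c → Q c) → count P? ≤ suc (count Q?)
count≤1+ P? Q? zero P⊆Q with P? zero | Q? zero
... | yes _ | yes _ = s≤s (m≤n⇒m≤1+n (count-mono (P? ∘ suc) (Q? ∘ suc) (P⊆Q λ ())))
... | yes _ | no _  = s≤s (count-mono (P? ∘ suc) (Q? ∘ suc) (P⊆Q λ ()))
... | no _  | yes _ = m≤n⇒m≤1+n (m≤n⇒m≤1+n (count-mono (P? ∘ suc) (Q? ∘ suc) (P⊆Q λ ())))
... | no _  | no _  = m≤n⇒m≤1+n (count-mono (P? ∘ suc) (Q? ∘ suc) (P⊆Q λ ()))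
count≤1+ P? Q? (suc e) P⊆Q with P? zero | Q? zero
... | yes p | no ¬q = contradiction (P⊆Q (λ ()) p) ¬q
... | yes _ | yes _ = s≤s (count≤1+ (P? ∘ suc) (Q? ∘ suc) e (λ c≢e → P⊆Q (c≢e ∘ suc-injectiveᶠ)))
... | no _  | yes _ = m≤n⇒m≤1+n (count≤1+ (P? ∘ suc) (Q? ∘ suc) e (λ c≢e → P⊆Q (c≢e ∘ suc-injectiveᶠ)))
... | no _  | no _  = count≤1+ (P? ∘ suc) (Q? ∘ suc) e (λ c≢e → P⊆Q (c≢e ∘ suc-injectiveᶠ))

count-split : {P : Pred (Fin n) ℓ₁} {Q : Pred (Fin n) ℓ₂} (P? : Decidable P) (Q? : Decidable Q) {e : Fin n} →
  P e → ¬ Q e → Q ⊆ P → (∀ {c} → c ≢ e → P c → Q c) → count P? ≡ suc (count Q?)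
count-split P? Q? {e} pe ¬qe Q⊆P P⊆Q = ≤-antisym (count≤1+ P? Q? e P⊆Q) (count-< Q? P? Q⊆P ¬qe pe)

count-complement : {P : Pred (Fin n) ℓ} (P? : Decidable P) → count P? + count (¬? ∘ P?) ≡ n
count-complement {n = zero}  P? = refl
count-complement {n = suc n} P? with P? zero
... | yes _ = cong suc (count-complement (P? ∘ suc))
... | no  _ = trans (+-suc (count (P? ∘ suc)) _) (cong suc (count-complement (P? ∘ suc)))

count-image≤ : ∀ {k} {P : Pred (Fin n) ℓ} (P? : Decidable P) (π : Fin k → Fin n) →
  P ⊆ (λ c → ∃ λ i → π i ≡ c) → count P? ≤ k
count-image≤ {k = zero}  P? π P⊆π = ≤-reflexive (count-∅ P? λ c p → case P⊆π p of λ { (() , _) })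
count-image≤ {k = suc k} {P = P} P? π P⊆π = begin
  count P?                   ≤⟨ count≤1+ P? (P? ∖ π zero) (π zero) (λ c≢π₀ p → p , c≢π₀) ⟩
  suc (count (P? ∖ π zero))  ≤⟨ s≤s (count-image≤ (P? ∖ π zero) (π ∘ suc) image) ⟩
  suc k                      ∎
  where
  open ≤-Reasoning
  image : ∀ {c} → P c × c ≢ π zero → ∃ λ i → π (suc i) ≡ c
  image (p , c≢π₀) with P⊆π p
  ... | zero  , π₀≡c = contradiction (sym π₀≡c) c≢π₀
  ... | suc i , πi≡c = i , πi≡c

-- Faces of the cube

-- A face fixes some coordinates (just b) and leaves the others free (nothing).
Face : ℕ → Set
Face n = Fin n → Maybe Bool

Agree : Maybe Bool → Bool → Set
Agree nothing  _ = ⊤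
Agree (just b) a = b ≡ a

agree? : (m : Maybe Bool) (a : Bool) → Dec (Agree m a)
agree? nothing  a = yes tt
agree? (just b) a = b ≟ᵇ a

infix 4 _∈ᶠ_
record _∈ᶠ_ (x : V n) (S : Face n) : Set where
  constructor agreeing
  field agrees : ∀ c → Agree (S c) (lookup x c)
open _∈ᶠ_

_∈ᶠ?_ : (x : V n) (S : Face n) → Dec (x ∈ᶠ S)
x ∈ᶠ? S = map′ agreeing agrees (all? λ c → agree? (S c) (lookup x c))

Compatible : Maybe Bool → Maybe Bool → Set
Compatible (just a) (just b) = a ≡ b
Compatible _        _        = ⊤

compatible? : (m m′ : Maybe Bool) → Dec (Compatible m m′)
compatible? (just a) (just b) = a ≟ᵇ b
compatible? (just a) nothing  = yes tt
compatible? nothing  _        = yes tt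

Meets : Face n → Face n → Set
Meets S G = ∀ c → Compatible (S c) (G c)

meets? : (S G : Face n) → Dec (Meets S G)
meets? S G = all? λ c → compatible? (S c) (G c)

free? : (m : Maybe Bool) → Dec (m ≡ nothing)
free? nothing  = yes refl
free? (just _) = no λ ()

free-in? : (S : Face n) → Decidable (λ c → S c ≡ nothing)
free-in? S c = free? (S c)

dim : Face n → ℕ
dim S = count (free-in? S)

infixl 6 _[_≔_]
_[_≔_] : Face n → Fin n → Bool → Face n
S [ e ≔ b ] = Vector.updateAt S e (const (just b))

≔-updates : (S : Face n) (e : Fin n) (b : Bool) → (S [ e ≔ b ]) e ≡ just b
≔-updates S e b = Vector.updateAt-updates e S

≔-minimal : (S : Face n) {e c : Fin n} (b : Bool) → c ≢ e → (S [ e ≔ b ]) c ≡ S c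
≔-minimal S {e} {c} b c≢e = Vector.updateAt-minimal c e S c≢e

free-≔ : (S : Face n) {e c : Fin n} {b : Bool} → (S [ e ≔ b ]) c ≡ nothing → c ≢ e × S c ≡ nothing
free-≔ S {e} {c} {b} free with c ≟ᶠ e
... | yes refl = case trans (sym (≔-updates S c b)) free of λ ()
... | no  c≢e  = c≢e , trans (sym (≔-minimal S b c≢e)) free

dim-≔ : (S : Face n) {e : Fin n} (b : Bool) → S e ≡ nothing → dim S ≡ suc (dim (S [ e ≔ b ]))
dim-≔ S {e} b Se = count-split (free-in? S) (free-in? (S [ e ≔ b ])) Se
  (λ Se′ → case trans (sym Se′) (≔-updates S e b) of λ ())
  (proj₂ ∘ free-≔ S)
  (λ c≢e Sc → trans (≔-minimal S b c≢e) Sc)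

toggle-∈ : {x : V n} {S : Face n} {e : Fin n} → x ∈ᶠ S → S e ≡ nothing → toggle x e ∈ᶠ S
toggle-∈ {x = x} {S} {e} x∈S Se = agreeing coordinate
  where
  coordinate : ∀ c → Agree (S c) (lookup (toggle x e) c)
  coordinate c with c ≟ᶠ e
  ... | yes refl rewrite Se = tt
  ... | no  c≢e  rewrite lookup-toggle-≢ x c≢e = agrees x∈S c

∈-≔ : {x : V n} {S : Face n} {e : Fin n} {b : Bool} → x ∈ᶠ S → lookup x e ≡ b → x ∈ᶠ S [ e ≔ b ]
∈-≔ {x = x} {S} {e} {b} x∈S xe≡b = agreeing coordinate
  where
  coordinate : ∀ c → Agree ((S [ e ≔ b ]) c) (lookup x c)
  coordinate c with c ≟ᶠ e
  ... | yes refl rewrite ≔-updates S c b = sym xe≡b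
  ... | no  c≢e  rewrite ≔-minimal S b c≢e = agrees x∈S c

∈∩∈⇒meets : {x : V n} {S G : Face n} → x ∈ᶠ S → x ∈ᶠ G → Meets S G
∈∩∈⇒meets {S = S} {G} x∈S x∈G c with S c | G c | agrees x∈S c | agrees x∈G c
... | just a  | just b  | a≡x | b≡x = trans a≡x (sym b≡x)
... | just a  | nothing | _   | _   = tt
... | nothing | _       | _   | _   = tt

meets-≔⇒meets : (S : Face n) {G : Face n} {e : Fin n} {b : Bool} →
  S e ≡ nothing → Meets (S [ e ≔ b ]) G → Meets S G
meets-≔⇒meets S {G} {e} {b} Se meets c with c ≟ᶠ e
... | yes refl rewrite Se = tt
... | no  c≢e  = subst (λ m → Compatible m (G c)) (≔-minimal S b c≢e) (meets c)

meets-≔⇒≢ : (S : Face n) {G : Face n} {e : Fin n} {b : Bool} →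
  Meets (S [ e ≔ b ]) G → G e ≢ just (not b)
meets-≔⇒≢ S {G} {e} {b} meets Ge with subst (λ m → Compatible m (G e)) (≔-updates S e b) (meets e)
... | compat rewrite Ge = not-¬ refl compat

toggle-unique : {x : V n} {G : Face n} {c c′ : Fin n} →
  ¬ x ∈ᶠ G → toggle x c ∈ᶠ G → toggle x c′ ∈ᶠ G → c ≡ c′
toggle-unique {x = x} {G} {c} {c′} x∉G xc∈G xc′∈G with c ≟ᶠ c′
... | yes c≡c′ = c≡c′
... | no  c≢c′ = contradiction x∈G x∉G
  where
  coordinate : ∀ d → Agree (G d) (lookup x d)
  coordinate d with d ≟ᶠ c
  ... | yes refl = subst (Agree (G d)) (lookup-toggle-≢ x c≢c′) (agrees xc′∈G d)
  ... | no  d≢c  = subst (Agree (G d)) (lookup-toggle-≢ x d≢c) (agrees xc∈G d)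
  x∈G : x ∈ᶠ G
  x∈G = agreeing coordinate

agree-fixed : {m : Maybe Bool} {a : Bool} → Agree m a → m ≢ nothing → m ≡ just a
agree-fixed {nothing} _    fixed = contradiction refl fixed
agree-fixed {just b}  refl _     = refl

disagree : {m : Maybe Bool} {a : Bool} → ¬ Agree m a → m ≡ just (not a)
disagree {nothing}     ¬agree = contradiction tt ¬agree
disagree {just b} {a}  ¬agree = cong just (¬-not ¬agree)

neither⇒nothing : {m : Maybe Bool} {b : Bool} → m ≢ just b → m ≢ just (not b) → m ≡ nothing
neither⇒nothing {nothing}         _   _    = refl
neither⇒nothing {just a}  {b} ≢b ≢¬b with a ≟ᵇ b
... | yes refl = contradiction refl ≢b
... | no  a≢b  = contradiction (cong just (¬-not a≢b)) ≢¬b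

meets-∈⇒free : {S G : Face n} {x : V n} {c : Fin n} →
  Meets S G → x ∈ᶠ S → G c ≡ just (not (lookup x c)) → S c ≡ nothing
meets-∈⇒free {S = S} {G} {x} {c} meets x∈S Gc with S c | agrees x∈S c | meets c
... | nothing | _    | _      = refl
... | just a  | refl | compat rewrite Gc = contradiction compat (not-¬ refl)

dim≡0⇒≡ : {S : Face n} {x y : V n} → dim S ≡ 0 → x ∈ᶠ S → y ∈ᶠ S → x ≡ y
dim≡0⇒≡ {S = S} {x} {y} dim≡0 x∈S y∈S = lookup-ext coordinate
  where
  coordinate : ∀ c → lookup x c ≡ lookup y c
  coordinate c with S c in Sc | agrees x∈S c | agrees y∈S c
  ... | just a  | a≡x | a≡y = trans (sym a≡x) a≡y
  ... | nothing | _   | _   = contradiction Sc (count≡0⇒∅ _ dim≡0 c)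

-- Subcubes are faces

module SubcubeIsFace {k N : ℕ} (f : V k → V N)
  (f-injective : ∀ y z → f y ≡ f z → y ≡ z)
  (f-adjacent : ∀ y z → Adj k y z → Adj N (f y) (f z)) where

  open ≡-Reasoning

  origin : V k
  origin = replicate k false

  base : V N
  base = f origin

  axis-spec : (i : Fin k) → ∃ λ c → f (toggle origin i) ≡ toggle base c
  axis-spec i = adjacent⇒toggle base _ (f-adjacent _ _ (adjacent-toggle origin i))

  axis : Fin k → Fin N
  axis i = proj₁ (axis-spec i)

  f-unit : (i : Fin k) → f (toggle origin i) ≡ toggle base (axis i)
  f-unit i = proj₂ (axis-spec i)

  axis-injective : {i j : Fin k} → axis i ≡ axis j → i ≡ j
  axis-injective {i} {j} eq with i ≟ᶠ j
  ... | yes i≡j = i≡j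
  ... | no  i≢j = contradiction (begin
        true                              ≡⟨ cong not (lookup-replicate i false) ⟨
        not (lookup origin i)             ≡⟨ lookup-toggle origin i ⟨
        lookup (toggle origin i) i        ≡⟨ cong (λ y → lookup y i) units≡ ⟩
        lookup (toggle origin j) i        ≡⟨ lookup-toggle-≢ origin i≢j ⟩
        lookup origin i                   ≡⟨ lookup-replicate i false ⟩
        false                             ∎) λ ()
    where
    units≡ : toggle origin i ≡ toggle origin j
    units≡ = f-injective _ _ (trans (f-unit i) (trans (cong (toggle base) eq) (sym (f-unit j))))

  axis⁻¹? : (c : Fin N) → Dec (∃ λ i → axis i ≡ c)
  axis⁻¹? c = any? λ i → axis i ≟ᶠ c

  bit : V k → {c : Fin N} → Dec (∃ λ i → axis i ≡ c) → Bool
  bit y (yes (i , _)) = lookup y i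
  bit y (no _)        = false

  -- The affine embedding that f turns out to be.
  spread : V k → V N
  spread y = tabulate λ c → lookup base c xor bit y (axis⁻¹? c)

  lookup-spread : (y : V k) (c : Fin N) → lookup (spread y) c ≡ lookup base c xor bit y (axis⁻¹? c)
  lookup-spread y c = lookup∘tabulate _ c

  bit-axis : (y : V k) (i : Fin k) → bit y (axis⁻¹? (axis i)) ≡ lookup y i
  bit-axis y i with axis⁻¹? (axis i)
  ... | yes (j , axis-j≡) = cong (lookup y) (axis-injective axis-j≡)
  ... | no  ∄            = contradiction (i , refl) ∄

  bit-toggle-≢ : (y : V k) {i : Fin k} {c : Fin N} → c ≢ axis i →
    bit (toggle y i) (axis⁻¹? c) ≡ bit y (axis⁻¹? c)
  bit-toggle-≢ y {i} {c} c≢axis-i with axis⁻¹? c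
  ... | yes (j , refl) = lookup-toggle-≢ y (c≢axis-i ∘ cong axis)
  ... | no  _          = refl

  bit-origin : {c : Fin N} (d : Dec (∃ λ i → axis i ≡ c)) → bit origin d ≡ false
  bit-origin (yes (i , _)) = lookup-replicate i false
  bit-origin (no _)        = refl

  spread-origin : spread origin ≡ base
  spread-origin = lookup-ext λ c → begin
    lookup (spread origin) c                        ≡⟨ lookup-spread origin c ⟩
    lookup base c xor bit origin (axis⁻¹? c)        ≡⟨ cong (lookup base c xor_) (bit-origin (axis⁻¹? c)) ⟩
    lookup base c xor false                         ≡⟨ xor-identityʳ _ ⟩
    lookup base c                                   ∎

  spread-toggle : (y : V k) (i : Fin k) → spread (toggle y i) ≡ toggle (spread y) (axis i)
  spread-toggle y i = lookup-ext coordinate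
    where
    coordinate : ∀ c → lookup (spread (toggle y i)) c ≡ lookup (toggle (spread y) (axis i)) c
    coordinate c with c ≟ᶠ axis i
    ... | yes refl = begin
      lookup (spread (toggle y i)) (axis i)                           ≡⟨ lookup-spread (toggle y i) (axis i) ⟩
      lookup base (axis i) xor bit (toggle y i) (axis⁻¹? (axis i))    ≡⟨ cong (lookup base (axis i) xor_) (bit-axis (toggle y i) i) ⟩
      lookup base (axis i) xor lookup (toggle y i) i                  ≡⟨ cong (lookup base (axis i) xor_) (lookup-toggle y i) ⟩
      lookup base (axis i) xor not (lookup y i)                       ≡⟨ not-distribʳ-xor (lookup base (axis i)) (lookup y i) ⟨
      not (lookup base (axis i) xor lookup y i)                       ≡⟨ cong (λ b → not (lookup base (axis i) xor b)) (bit-axis y i) ⟨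
      not (lookup base (axis i) xor bit y (axis⁻¹? (axis i)))         ≡⟨ cong not (lookup-spread y (axis i)) ⟨
      not (lookup (spread y) (axis i))                                ≡⟨ lookup-toggle (spread y) (axis i) ⟨
      lookup (toggle (spread y) (axis i)) (axis i)                    ∎
    ... | no c≢axis-i = begin
      lookup (spread (toggle y i)) c                   ≡⟨ lookup-spread (toggle y i) c ⟩
      lookup base c xor bit (toggle y i) (axis⁻¹? c)   ≡⟨ cong (lookup base c xor_) (bit-toggle-≢ y c≢axis-i) ⟩
      lookup base c xor bit y (axis⁻¹? c)              ≡⟨ lookup-spread y c ⟨
      lookup (spread y) c                              ≡⟨ lookup-toggle-≢ (spread y) c≢axis-i ⟨
      lookup (toggle (spread y) (axis i)) c            ∎

  f-square : (y : V k) {i j : Fin k} → i ≢ j →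
    f (toggle (toggle y i) j) ≡ spread (toggle (toggle y i) j) →
    f (toggle y i) ≡ spread (toggle y i) → f (toggle y j) ≡ spread (toggle y j) → f y ≡ spread y
  f-square y {i} {j} i≢j fy₀ fyi fyj
    with common-neighbour (spread y₀) (f y) (i≢j ∘ sym ∘ axis-injective) y~yi y~yj
    where
    y₀ : V k
    y₀ = toggle (toggle y i) j
    yi≡ : toggle y i ≡ toggle y₀ j
    yi≡ = sym (toggle-involutive (toggle y i) j)
    yj≡ : toggle y j ≡ toggle y₀ i
    yj≡ = sym (trans (cong (λ w → toggle w i) (toggle-comm y i≢j)) (toggle-involutive (toggle y j) i))
    y~yi : Adj N (f y) (toggle (spread y₀) (axis j))
    y~yi = subst (Adj N (f y)) (trans fyi (trans (cong spread yi≡) (spread-toggle y₀ j)))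
                 (f-adjacent _ _ (adjacent-toggle y i))
    y~yj : Adj N (f y) (toggle (spread y₀) (axis i))
    y~yj = subst (Adj N (f y)) (trans fyj (trans (cong spread yj≡) (spread-toggle y₀ i)))
                 (f-adjacent _ _ (adjacent-toggle y j))
  ... | inj₁ fy≡ = contradiction (begin
        lookup y i                              ≡⟨ cong (λ w → lookup w i) (f-injective _ _ (trans fy≡ (sym fy₀))) ⟩
        lookup (toggle (toggle y i) j) i        ≡⟨ lookup-toggle-≢ (toggle y i) i≢j ⟩
        lookup (toggle y i) i                   ≡⟨ lookup-toggle y i ⟩
        not (lookup y i)                        ∎) (not-¬ refl)
  ... | inj₂ fy≡ = begin
        f y                                                      ≡⟨ fy≡ ⟩
        toggle (toggle (spread (toggle (toggle y i) j)) (axis j)) (axis i) ≡⟨ cong (λ w → toggle w (axis i)) (spread-toggle _ j) ⟨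
        toggle (spread (toggle (toggle (toggle y i) j) j)) (axis i) ≡⟨ spread-toggle _ i ⟨
        spread (toggle (toggle (toggle (toggle y i) j) j) i)     ≡⟨ cong (λ w → spread (toggle w i)) (toggle-involutive (toggle y i) j) ⟩
        spread (toggle (toggle y i) i)                           ≡⟨ cong spread (toggle-involutive y i) ⟩
        spread y                                                 ∎

  weight : V k → ℕ
  weight y = count λ i → lookup y i ≟ᵇ true

  weight-toggle : (y : V k) {i : Fin k} → lookup y i ≡ true → weight y ≡ suc (weight (toggle y i))
  weight-toggle y {i} yi = count-split _ _ yi
    (λ yi′ → case trans (sym yi′) (trans (lookup-toggle y i) (cong not yi)) of λ ())
    (λ {c} yc′ → case c ≟ᶠ i of λ where
      (yes refl) → yi
      (no c≢i)   → trans (sym (lookup-toggle-≢ y c≢i)) yc′)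
    (λ c≢i yc → trans (lookup-toggle-≢ y c≢i) yc)

  weight≡0⇒origin : (y : V k) → weight y ≡ 0 → y ≡ origin
  weight≡0⇒origin y w≡0 = lookup-ext λ c →
    trans (¬-not (count≡0⇒∅ _ w≡0 c)) (sym (lookup-replicate c false))

  one-of-weight : (y : V k) {w : ℕ} → weight y ≡ suc w → ∃ λ i → lookup y i ≡ true × weight (toggle y i) ≡ w
  one-of-weight y w≡ with count>0⇒∃ _ (subst (0 <_) (sym w≡) (s≤s z≤n))
  ... | i , yi = i , yi , suc-injective (trans (sym (weight-toggle y yi)) w≡)

  two-of-weight : (y : V k) {w : ℕ} → weight y ≡ suc (suc w) → ∃₂ λ i j → i ≢ j
    × weight (toggle (toggle y i) j) ≡ w × weight (toggle y i) ≡ suc w × weight (toggle y j) ≡ suc w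
  two-of-weight y {w} w≡ with one-of-weight y w≡
  ... | i , yi , w-yi with one-of-weight (toggle y i) w-yi
  ... | j , yij , w-yij = i , j , i≢j , w-yij , w-yi , w-yj
    where
    i≢j : i ≢ j
    i≢j refl = case trans (sym yij) (trans (lookup-toggle y i) (cong not yi)) of λ ()
    w-yj : weight (toggle y j) ≡ suc w
    w-yj = suc-injective (trans (sym (weight-toggle y (trans (sym (lookup-toggle-≢ y (i≢j ∘ sym))) yij))) w≡)

  f≗spread-of-weight : (w : ℕ) (y : V k) → weight y ≡ w → f y ≡ spread y
  f≗spread-of-weight zero y w≡0 rewrite weight≡0⇒origin y w≡0 = sym spread-origin
  f≗spread-of-weight (suc zero) y w≡1 with one-of-weight y w≡1
  ... | i , _ , w-yi = begin
    f y                             ≡⟨ cong f y≡unit ⟩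
    f (toggle origin i)             ≡⟨ f-unit i ⟩
    toggle base (axis i)            ≡⟨ cong (λ b → toggle b (axis i)) spread-origin ⟨
    toggle (spread origin) (axis i) ≡⟨ spread-toggle origin i ⟨
    spread (toggle origin i)        ≡⟨ cong spread y≡unit ⟨
    spread y                        ∎
    where
    y≡unit : y ≡ toggle origin i
    y≡unit = trans (sym (toggle-involutive y i)) (cong (λ z → toggle z i) (weight≡0⇒origin _ w-yi))
  f≗spread-of-weight (suc (suc w)) y w≡ =
    let i , j , i≢j , w-yij , w-yi , w-yj = two-of-weight y w≡
    in f-square y i≢j (f≗spread-of-weight w _ w-yij)
         (f≗spread-of-weight (suc w) _ w-yi) (f≗spread-of-weight (suc w) _ w-yj)

  f≗spread : (y : V k) → f y ≡ spread y
  f≗spread y = f≗spread-of-weight (weight y) y refl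

  face : Face N
  face c with axis⁻¹? c
  ... | yes _ = nothing
  ... | no  _ = just (lookup base c)

  spread∈face : (y : V k) → spread y ∈ᶠ face
  spread∈face y = agreeing coordinate
    where
    coordinate : ∀ c → Agree (face c) (lookup (spread y) c)
    coordinate c rewrite lookup-spread y c with axis⁻¹? c
    ... | yes _ = tt
    ... | no  _ = sym (xor-identityʳ _)

  coordinates : V N → V k
  coordinates x = tabulate λ i → lookup base (axis i) xor lookup x (axis i)

  ∈face⇒spread : (x : V N) → x ∈ᶠ face → spread (coordinates x) ≡ x
  ∈face⇒spread x x∈face = lookup-ext coordinate
    where
    coordinate : ∀ c → lookup (spread (coordinates x)) c ≡ lookup x c
    coordinate c rewrite lookup-spread (coordinates x) c with axis⁻¹? c | agrees x∈face c
    ... | yes (i , refl) | _ rewrite lookup∘tabulate (λ i → lookup base (axis i) xor lookup x (axis i)) i =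
      trans (sym (xor-assoc b b (lookup x (axis i)))) (cong (_xor lookup x (axis i)) (xor-same b))
      where
      b : Bool
      b = lookup base (axis i)
    ... | no _ | base≡x = trans (xor-identityʳ _) base≡x

  dim-face≤ : dim face ≤ k
  dim-face≤ = count-image≤ _ axis free⇒axis
    where
    free⇒axis : ∀ {c} → face c ≡ nothing → ∃ λ i → axis i ≡ c
    free⇒axis {c} free with axis⁻¹? c
    ... | yes axis⁻¹c = axis⁻¹c

subcube⇒face : ∀ {N k} {U : VSet N} → IsSubcube N k U →
  Σ (Face N) λ F → (∀ x → x ∈ᶠ F ⇔ U x) × dim F ≤ k
subcube⇒face {U = U} (f , f-injective , image , adjacent) =
  face , (λ x → mk⇔ (face⇒U x) (U⇒face x)) , dim-face≤
  where
  open SubcubeIsFace f f-injective (λ y z → Equivalence.to (adjacent y z))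
  U⇒face : ∀ x → U x → x ∈ᶠ face
  U⇒face x Ux with Equivalence.to (image x) Ux
  ... | y , refl = subst (_∈ᶠ face) (sym (f≗spread y)) (spread∈face y)
  face⇒U : ∀ x → x ∈ᶠ face → U x
  face⇒U x x∈face = Equivalence.from (image x) (coordinates x , trans (f≗spread _) (∈face⇒spread x x∈face))

-- Routing around faulty faces

faces : ∀ {t} → (Fin t → Face n) → Fin t → VSet n
faces F i x = x ∈ᶠ F i

alive-cons : ∀ {t} {F : Fin (suc t) → Face n} {x : V n} →
  ¬ x ∈ᶠ F zero → Alive (faces (F ∘ suc)) x → Alive (faces F) x
alive-cons x∉F₀ live (zero  , x∈F₀) = x∉F₀ x∈F₀
alive-cons x∉F₀ live (suc i , x∈Fi) = live (i , x∈Fi)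

alive-tail : ∀ {t} {F : Fin (suc t) → Face n} {x : V n} → Alive (faces F) x → Alive (faces (F ∘ suc)) x
alive-tail live (i , x∈Fi) = live (suc i , x∈Fi)

-- Pigeonhole: a fault meeting S blocks at most one direction out of u (toggle-unique), and a fault
-- missing S blocks none of the directions inside S.
live-neighbour : ∀ {N t ℓ} (F : Fin t → Face N) {S : Face N} {u : V N} {P : Pred (Fin N) ℓ} (P? : Decidable P) →
  (∀ {c} → P c → S c ≡ nothing) → u ∈ᶠ S → Alive (faces F) u →
  count (λ i → meets? S (F i)) < count P? → ∃ λ c → P c × Alive (faces F) (toggle u c)
live-neighbour {t = zero} F P? _ _ _ fewer =
  let c , p = count>0⇒∃ P? (≤-trans (s≤s z≤n) fewer) in c , p , λ { (() , _) }
live-neighbour {t = suc t} F {S} {u} P? P⊆free u∈S live-u fewer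
  with meets? S (F zero) | any? (λ c → P? c ×-dec (toggle u c ∈ᶠ? F zero))
... | no ¬meets | yes (c , p , blocked) = contradiction (∈∩∈⇒meets (toggle-∈ u∈S (P⊆free p)) blocked) ¬meets
... | no _      | no unblocked =
  let c , p , live = live-neighbour (F ∘ suc) P? P⊆free u∈S (alive-tail live-u) fewer
  in c , p , alive-cons (λ blocked → unblocked (c , p , blocked)) live
... | yes _     | no unblocked =
  let c , p , live = live-neighbour (F ∘ suc) P? P⊆free u∈S (alive-tail live-u) (<⇒≤ fewer)
  in c , p , alive-cons (λ blocked → unblocked (c , p , blocked)) live
... | yes _     | yes (c₀ , p₀ , blocked₀) =
  let c , (p , c≢c₀) , live = live-neighbour (F ∘ suc) (P? ∖ c₀) (P⊆free ∘ proj₁) u∈S (alive-tail live-u) fewer′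
  in c , p , alive-cons (λ blocked → c≢c₀ (toggle-unique (λ u∈F₀ → live-u (zero , u∈F₀)) blocked blocked₀)) live
  where
  fewer′ : count (λ i → meets? S (F (suc i))) < count (P? ∖ c₀)
  fewer′ = ≤-pred (≤-trans fewer (count≤1+ P? (P? ∖ c₀) c₀ (λ c≢c₀ p → p , c≢c₀)))

module Routing {N t : ℕ} (F : Fin t → Face N) where

  Live : V N → Set
  Live = Alive (faces F)

  meeting? : (S : Face N) → Decidable (λ i → Meets S (F i))
  meeting? S i = meets? S (F i)

  #meeting : Face N → ℕ
  #meeting S = count (meeting? S)

  fixed-free? : (G S : Face N) → Decidable (λ c → G c ≢ nothing × S c ≡ nothing)
  fixed-free? G S c = ¬? (free? (G c)) ×-dec free? (S c)

  -- When G meets S, this is the codimension of G ∩ S in S.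
  codim-in : Face N → Face N → ℕ
  codim-in G S = count (fixed-free? G S)

  Sparse : ℕ → Face N → Set
  Sparse j S = ∀ i → Meets S (F i) → j + #meeting S ≤ codim-in (F i) S

  #meeting-≔ : (S : Face N) {e : Fin N} {b : Bool} → S e ≡ nothing → #meeting (S [ e ≔ b ]) ≤ #meeting S
  #meeting-≔ S {e} {b} Se = count-mono (meeting? (S [ e ≔ b ])) (meeting? S) (meets-≔⇒meets S Se)

  #meeting-≔-< : (S : Face N) {e : Fin N} {b : Bool} {i₀ : Fin t} →
    S e ≡ nothing → Meets S (F i₀) → F i₀ e ≡ just (not b) → #meeting (S [ e ≔ b ]) < #meeting S
  #meeting-≔-< S {e} {b} Se meets cut = count-< (meeting? (S [ e ≔ b ])) (meeting? S)
    (meets-≔⇒meets S Se) (λ meets′ → meets-≔⇒≢ S meets′ cut) meets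

  codim-in-≔ : (G S : Face N) {e : Fin N} {b : Bool} → codim-in G S ≤ suc (codim-in G (S [ e ≔ b ]))
  codim-in-≔ G S {e} {b} = count≤1+ (fixed-free? G S) (fixed-free? G (S [ e ≔ b ])) e
    λ c≢e (fixed , Sc) → fixed , trans (≔-minimal S b c≢e) Sc

  codim-in-≔-free : (G S : Face N) {e : Fin N} {b : Bool} → G e ≡ nothing → codim-in G S ≤ codim-in G (S [ e ≔ b ])
  codim-in-≔-free G S {e} {b} Ge = count-mono (fixed-free? G S) (fixed-free? G (S [ e ≔ b ])) λ (fixed , Sc) →
    fixed , trans (≔-minimal S b λ { refl → fixed Ge }) Sc

  module _ (S : Face N) {e : Fin N} {b : Bool} (Se : S e ≡ nothing) where

    private
      S′ : Face N
      S′ = S [ e ≔ b ]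

    sparse-≔ : ∀ {j} → Sparse (suc j) S → Sparse j S′
    sparse-≔ {j} sparse i meets′ = ≤-pred $ begin
      suc (j + #meeting S′)    ≤⟨ s≤s (+-monoʳ-≤ j (#meeting-≔ S Se)) ⟩
      suc (j + #meeting S)     ≤⟨ sparse i (meets-≔⇒meets S Se meets′) ⟩
      codim-in (F i) S         ≤⟨ codim-in-≔ (F i) S ⟩
      suc (codim-in (F i) S′)  ∎
      where open ≤-Reasoning

    sparse-≔-cut : ∀ {j i₀} → Meets S (F i₀) → F i₀ e ≡ just (not b) → Sparse j S → Sparse j S′
    sparse-≔-cut {j} meets₀ cut sparse i meets′ = ≤-pred $ begin
      suc (j + #meeting S′)    ≡⟨ +-suc j _ ⟨
      j + suc (#meeting S′)    ≤⟨ +-monoʳ-≤ j (#meeting-≔-< S Se meets₀ cut) ⟩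
      j + #meeting S           ≤⟨ sparse i (meets-≔⇒meets S Se meets′) ⟩
      codim-in (F i) S         ≤⟨ codim-in-≔ (F i) S ⟩
      suc (codim-in (F i) S′)  ∎
      where open ≤-Reasoning

    sparse-≔-free : ∀ {j} → (∀ i → Meets S′ (F i) → F i e ≡ nothing) → Sparse j S → Sparse j S′
    sparse-≔-free {j} free sparse i meets′ = begin
      j + #meeting S′          ≤⟨ +-monoʳ-≤ j (#meeting-≔ S Se) ⟩
      j + #meeting S           ≤⟨ sparse i (meets-≔⇒meets S Se meets′) ⟩
      codim-in (F i) S         ≤⟨ codim-in-≔-free (F i) S (free i meets′) ⟩
      codim-in (F i) S′        ∎
      where open ≤-Reasoning

    sparse-≔-cut-free : ∀ {j i₀} → Meets S (F i₀) → F i₀ e ≡ just (not b) →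
      (∀ i → Meets S′ (F i) → F i e ≡ nothing) → Sparse j S → Sparse (suc j) S′
    sparse-≔-cut-free {j} meets₀ cut free sparse i meets′ = begin
      suc (j + #meeting S′)    ≡⟨ +-suc j _ ⟨
      j + suc (#meeting S′)    ≤⟨ +-monoʳ-≤ j (#meeting-≔-< S Se meets₀ cut) ⟩
      j + #meeting S           ≤⟨ sparse i (meets-≔⇒meets S Se meets′) ⟩
      codim-in (F i) S         ≤⟨ codim-in-≔-free (F i) S (free i meets′) ⟩
      codim-in (F i) S′        ∎
      where open ≤-Reasoning

  sparse-weaken : ∀ {j} (S : Face N) → Sparse (suc j) S → Sparse j S
  sparse-weaken S sparse i meets = ≤-trans (n≤1+n _) (sparse i meets)

  live-toggle : {x : V N} {S : Face N} {e : Fin N} → x ∈ᶠ S → S e ≡ nothing → Live x →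
    (∀ i → Meets S (F i) → F i e ≢ just (not (lookup x e))) → Live (toggle x e)
  live-toggle {x} {S} {e} x∈S Se live-x uncut (i , xe∈Fi) with F i e in Fie
  ... | nothing = live-x (i , subst (_∈ᶠ F i) (toggle-involutive x e) (toggle-∈ xe∈Fi Fie))
  ... | just β  = uncut i (∈∩∈⇒meets (toggle-∈ x∈S Se) xe∈Fi) (begin
    F i e                              ≡⟨ agree-fixed (agrees xe∈Fi e) (λ Fie′ → case trans (sym Fie) Fie′ of λ ()) ⟩
    just (lookup (toggle x e) e)       ≡⟨ cong just (lookup-toggle x e) ⟩
    just (not (lookup x e))            ∎)
    where open ≡-Reasoning

  Antipodal : Face N → V N → V N → Set
  Antipodal S u v = ∀ c → S c ≡ nothing → lookup u c ≢ lookup v c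

  -- If a free neighbour of u lies in a fault H, pigeonhole among the coordinates H fixes gives a live
  -- step, and fixing it to v's value cuts H off; otherwise a fault meeting S is cut off where it
  -- disagrees with v.
  antipodal-step : {S : Face N} {u v : V N} → Sparse 1 S → 0 < dim S → u ∈ᶠ S → v ∈ᶠ S →
    Antipodal S u v → Live u → Live v →
    ∃ λ c → S c ≡ nothing × Live (toggle u c) × Sparse 1 (S [ c ≔ lookup v c ])
  antipodal-step {S} {u} {v} sparse pos u∈S v∈S anti live-u live-v
    with any? (λ i → any? (λ c → free? (S c) ×-dec (toggle u c ∈ᶠ? F i)))
  ... | yes (i₀ , c₀ , Sc₀ , blocked) =
    let c , (fixed , Sc) , live-uc = live-neighbour F (fixed-free? (F i₀) S) proj₂ u∈S live-u (sparse i₀ meets₀)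
    in c , Sc , live-uc , sparse-≔-cut S Sc meets₀ (F-cuts c fixed Sc live-uc) sparse
    where
    meets₀ : Meets S (F i₀)
    meets₀ = ∈∩∈⇒meets (toggle-∈ u∈S Sc₀) blocked
    F-cuts : ∀ c → F i₀ c ≢ nothing → S c ≡ nothing → Live (toggle u c) → F i₀ c ≡ just (not (lookup v c))
    F-cuts c fixed Sc live-uc = begin
      F i₀ c                           ≡⟨ agree-fixed (agrees blocked c) fixed ⟩
      just (lookup (toggle u c₀) c)    ≡⟨ cong just (lookup-toggle-≢ u c≢c₀) ⟩
      just (lookup u c)                ≡⟨ cong just (¬-not (anti c Sc)) ⟩
      just (not (lookup v c))          ∎
      where
      open ≡-Reasoning
      c≢c₀ : c ≢ c₀
      c≢c₀ refl = live-uc (i₀ , blocked)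
  ... | no unblocked with any? (λ i → meets? S (F i))
  ...   | yes (i , meets) =
    let c , ¬agree = ¬∀⟶∃¬ N _ (λ c → agree? (F i c) (lookup v c)) (λ v∈Fi → live-v (i , agreeing v∈Fi))
        Fic = disagree ¬agree
        Sc = meets-∈⇒free meets v∈S Fic
    in c , Sc , (λ (i′ , blocked) → unblocked (i′ , c , Sc , blocked)) , sparse-≔-cut S Sc meets Fic sparse
  ...   | no none =
    let c , Sc = count>0⇒∃ (free-in? S) pos
    in c , Sc , (λ (i′ , blocked) → unblocked (i′ , c , Sc , blocked)) ,
       λ i meets′ → contradiction (i , meets-≔⇒meets S Sc meets′) none

  antipodal-walk : ∀ d (S : Face N) {u v : V N} → dim S ≡ d → Sparse 1 S → u ∈ᶠ S → v ∈ᶠ S →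
    Antipodal S u v → Live u → Live v → Walk (faces F) u v d
  antipodal-walk zero S {u} dim≡0 _ u∈S v∈S _ live-u _ =
    subst (λ w → Walk (faces F) u w 0) (dim≡0⇒≡ dim≡0 u∈S v∈S) (here live-u)
  antipodal-walk (suc d) S {u} {v} dim≡ sparse u∈S v∈S anti live-u live-v
    with antipodal-step sparse (subst (0 <_) (sym dim≡) (s≤s z≤n)) u∈S v∈S anti live-u live-v
  ... | c , Sc , live-uc , sparse′ =
    step live-u (adjacent-toggle u c) (antipodal-walk d S′ dim′ sparse′ uc∈S′ (∈-≔ v∈S refl) anti′ live-uc live-v)
    where
    S′ : Face N
    S′ = S [ c ≔ lookup v c ]
    dim′ : dim S′ ≡ d
    dim′ = suc-injective (trans (sym (dim-≔ S (lookup v c) Sc)) dim≡)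
    uc∈S′ : toggle u c ∈ᶠ S′
    uc∈S′ = ∈-≔ (toggle-∈ u∈S Sc) (trans (lookup-toggle u c) (sym (¬-not (anti c Sc ∘ sym))))
    anti′ : Antipodal S′ (toggle u c) v
    anti′ c′ S′c′ = let c′≢c , Sc′ = free-≔ S S′c′ in anti c′ Sc′ ∘ trans (sym (lookup-toggle-≢ u c′≢c))

  sparse-or-detour : (S : Face N) {e : Fin N} (b : Bool) → S e ≡ nothing → Sparse 2 S →
    Sparse 2 (S [ e ≔ b ]) ⊎
    (∃ (λ i₀ → Meets S (F i₀) × F i₀ e ≡ just b) × (∀ i → Meets S (F i) → F i e ≢ just (not b)))
  sparse-or-detour S {e} b Se sparse with any? (λ i → meets? S (F i) ×-dec (≡-dec _≟ᵇ_ (F i e) (just (not b))))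
  ... | yes (i₀ , meets₀ , cut) = inj₁ (sparse-≔-cut S Se meets₀ cut sparse)
  ... | no uncut with any? (λ i → meets? S (F i) ×-dec (≡-dec _≟ᵇ_ (F i e) (just b)))
  ...   | yes fixed = inj₂ (fixed , λ i meets cut → uncut (i , meets , cut))
  ...   | no unfixed = inj₁ (sparse-≔-free S Se free sparse)
    where
    free : ∀ i → Meets (S [ e ≔ b ]) (F i) → F i e ≡ nothing
    free i meets′ = neither⇒nothing (λ Fie → unfixed (i , meets-≔⇒meets S Se meets′ , Fie)) (meets-≔⇒≢ S meets′)

  ShortWalk : Face N → V N → V N → Set
  ShortWalk S u v = ∃ λ ℓ → ℓ ≤ dim S × Walk (faces F) u v ℓ

  ShortWalk-≔ : (S : Face N) {e : Fin N} {b : Bool} {u v : V N} → S e ≡ nothing →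
    ShortWalk (S [ e ≔ b ]) u v → ShortWalk S u v
  ShortWalk-≔ S {b = b} Se (ℓ , ℓ≤ , walk) =
    ℓ , ≤-trans ℓ≤ (≤-trans (n≤1+n _) (≤-reflexive (sym (dim-≔ S b Se)))) , walk

  ShortWalk-around : {S S₂ : Face N} {u v : V N} (e : Fin N) → dim S ≡ suc (suc (dim S₂)) →
    Live u → Live v → ShortWalk S₂ (toggle u e) (toggle v e) → ShortWalk S u v
  ShortWalk-around {u = u} {v} e dim≡ live-u live-v (ℓ , ℓ≤ , walk) =
    suc (suc ℓ) , subst (suc (suc ℓ) ≤_) (sym dim≡) (s≤s (s≤s ℓ≤)) ,
    step live-u (adjacent-toggle u e) (walk-snoc walk ve~v live-v)
    where
    ve~v : Adj N (toggle v e) v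
    ve~v = subst (Adj N (toggle v e)) (toggle-involutive v e) (adjacent-toggle (toggle v e) e)

  Agreement : Face N → V N → V N → Set
  Agreement S u v = ∃ λ e → S e ≡ nothing × lookup u e ≡ lookup v e

  agreement? : (S : Face N) (u v : V N) → Dec (Agreement S u v)
  agreement? S u v = any? λ e → free? (S e) ×-dec (lookup u e ≟ᵇ lookup v e)

  antipodal-short-walk : (S : Face N) {u v : V N} → Sparse 1 S → u ∈ᶠ S → v ∈ᶠ S →
    ¬ Agreement S u v → Live u → Live v → ShortWalk S u v
  antipodal-short-walk S sparse u∈S v∈S ¬agree live-u live-v =
    dim S , ≤-refl , antipodal-walk (dim S) S refl sparse u∈S v∈S (λ c Sc eq → ¬agree (c , Sc , eq)) live-u live-v

  short-walk : ∀ n (S : Face N) {u v : V N} → dim S ≤ n → Sparse 2 S → u ∈ᶠ S → v ∈ᶠ S →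
    Live u → Live v → ShortWalk S u v
  short-walk-fixing : ∀ n (S : Face N) {u v : V N} {e : Fin N} → dim S ≤ n → Sparse 2 S → u ∈ᶠ S → v ∈ᶠ S →
    Live u → Live v → S e ≡ nothing → lookup u e ≡ lookup v e → ShortWalk S u v
  detour : ∀ n (S : Face N) {u v : V N} {e : Fin N} → dim S ≤ suc n → Sparse 2 S → u ∈ᶠ S → v ∈ᶠ S →
    Live u → Live v → S e ≡ nothing → lookup u e ≡ lookup v e →
    ∃ (λ i₀ → Meets S (F i₀) × F i₀ e ≡ just (lookup u e)) →
    (∀ i → Meets S (F i) → F i e ≢ just (not (lookup u e))) → ShortWalk S u v

  short-walk n S {u} {v} dim≤ sparse u∈S v∈S live-u live-v with agreement? S u v
  ... | yes (e , Se , ue≡ve) = short-walk-fixing n S dim≤ sparse u∈S v∈S live-u live-v Se ue≡ve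
  ... | no ¬agree = antipodal-short-walk S (sparse-weaken S sparse) u∈S v∈S ¬agree live-u live-v

  short-walk-fixing zero S dim≤ _ _ _ _ _ Se _ = contradiction (trans (sym (dim-≔ S true Se)) (n≤0⇒n≡0 dim≤)) λ ()
  short-walk-fixing (suc n) S {u} {v} {e} dim≤ sparse u∈S v∈S live-u live-v Se ue≡ve
    with sparse-or-detour S (lookup u e) Se sparse
  ... | inj₁ sparse′ = ShortWalk-≔ S Se
    (short-walk n (S [ e ≔ lookup u e ]) (≤-pred (subst (_≤ suc n) (dim-≔ S (lookup u e) Se) dim≤)) sparse′
      (∈-≔ u∈S refl) (∈-≔ v∈S (sym ue≡ve)) live-u live-v)
  ... | inj₂ (blocker , uncut) = detour n S dim≤ sparse u∈S v∈S live-u live-v Se ue≡ve blocker uncut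

  detour n S {u} {v} {e} dim≤ sparse u∈S v∈S live-u live-v Se ue≡ve (i₀ , meets₀ , Fi₀e) uncut
    with agreement? (S [ e ≔ lookup u e ]) u v
  ... | no ¬agree = ShortWalk-≔ S Se
    (antipodal-short-walk _ (sparse-≔ S Se sparse) (∈-≔ u∈S refl) (∈-≔ v∈S (sym ue≡ve)) ¬agree live-u live-v)
  ... | yes (e′ , S′e′ , ue′≡ve′) = ShortWalk-around e dim₂ live-u live-v
    (short-walk n S₂ dim₂≤n sparse₂ ue∈S₂ ve∈S₂ (live-toggle u∈S Se live-u uncut) (live-toggle v∈S Se live-v uncut′))
    where
    b : Bool
    b = lookup u e
    e′≢e : e′ ≢ e
    e′≢e = proj₁ (free-≔ S S′e′)
    S₁ : Face N
    S₁ = S [ e ≔ not b ]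
    S₁e′ : S₁ e′ ≡ nothing
    S₁e′ = trans (≔-minimal S (not b) e′≢e) (proj₂ (free-≔ S S′e′))
    S₂ : Face N
    S₂ = S₁ [ e′ ≔ lookup u e′ ]
    free : ∀ i → Meets S₁ (F i) → F i e ≡ nothing
    free i meets′ = neither⇒nothing (uncut i (meets-≔⇒meets S Se meets′)) (meets-≔⇒≢ S meets′)
    sparse₂ : Sparse 2 S₂
    sparse₂ = sparse-≔ S₁ S₁e′
      (sparse-≔-cut-free S Se meets₀ (trans Fi₀e (cong just (sym (not-involutive b)))) free sparse)
    dim₂ : dim S ≡ suc (suc (dim S₂))
    dim₂ = trans (dim-≔ S (not b) Se) (cong suc (dim-≔ S₁ (lookup u e′) S₁e′))
    dim₂≤n : dim S₂ ≤ n
    dim₂≤n = ≤-trans (n≤1+n _) (≤-pred (subst (_≤ suc n) dim₂ dim≤))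
    ue∈S₂ : toggle u e ∈ᶠ S₂
    ue∈S₂ = ∈-≔ (∈-≔ (toggle-∈ u∈S Se) (lookup-toggle u e)) (lookup-toggle-≢ u e′≢e)
    ve∈S₂ : toggle v e ∈ᶠ S₂
    ve∈S₂ = ∈-≔ (∈-≔ (toggle-∈ v∈S Se) (trans (lookup-toggle v e) (cong not (sym ue≡ve))))
                (trans (lookup-toggle-≢ v e′≢e) (sym ue′≡ve′))
    uncut′ : ∀ i → Meets S (F i) → F i e ≢ just (not (lookup v e))
    uncut′ = subst (λ a → ∀ i → Meets S (F i) → F i e ≢ just (not a)) ue≡ve uncut

  full : Face N
  full _ = nothing

  dim+codim-in-full : (G : Face N) → dim G + codim-in G full ≡ N
  dim+codim-in-full G = trans (cong (dim G +_) (count-≐ (fixed-free? G full) (¬? ∘ free-in? G) proj₁ (_, refl)))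
                              (count-complement (free-in? G))

  diameter≤N : (∀ i → t + 2 + dim (F i) ≤ N) → DiamLe N (faces F) N
  diameter≤N small u v live-u live-v =
    let ℓ , ℓ≤ , walk = short-walk N full (count≤n _) sparse (agreeing λ _ → tt) (agreeing λ _ → tt) live-u live-v
    in ℓ , ≤-trans ℓ≤ (count≤n _) , walk
    where
    sparse : Sparse 2 full
    sparse i _ = +-cancelˡ-≤ (dim (F i)) _ _ $ begin
      dim (F i) + (2 + #meeting full)   ≤⟨ +-monoʳ-≤ (dim (F i)) (+-monoʳ-≤ 2 (count≤n (meeting? full))) ⟩
      dim (F i) + (2 + t)               ≡⟨ +-comm (dim (F i)) (2 + t) ⟩
      2 + t + dim (F i)                 ≡⟨ cong (_+ dim (F i)) (+-comm 2 t) ⟩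
      t + 2 + dim (F i)                 ≤⟨ small i ⟩
      N                                 ≡⟨ dim+codim-in-full (F i) ⟨
      dim (F i) + codim-in (F i) full   ∎
      where open ≤-Reasoning

t+2+m≤n∸1 : ∀ {m n t} → m + 3 ≤ n → t ≤ n ∸ m ∸ 3 → t + 2 + m ≤ n ∸ 1
t+2+m≤n∸1 {m} {zero}  m+3≤0 _ = contradiction (≤-trans (m≤n+m 3 m) m+3≤0) λ ()
t+2+m≤n∸1 {m} {suc n} {t} m+3≤n t≤ = ≤-pred $ begin
  suc (t + 2 + m)            ≡⟨ cong suc (+-assoc t 2 m) ⟩
  suc (t + (2 + m))          ≡⟨ +-suc t (2 + m) ⟨
  t + (3 + m)                ≡⟨ cong (t +_) (+-comm 3 m) ⟩
  t + (m + 3)                ≤⟨ +-monoˡ-≤ (m + 3) (subst (t ≤_) (∸-+-assoc (suc n) m 3) t≤) ⟩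
  suc n ∸ (m + 3) + (m + 3)  ≡⟨ m∸n+n≡m m+3≤n ⟩
  suc n                      ∎
  where open ≤-Reasoning

lemma4p3 : (m n : ℕ) → m + 3 ≤ n → DscfLe (n ∸ 1) m n →
    (t : ℕ) (A : Fin t → VSet (n ∸ 1)) → t ≤ n ∸ m ∸ 3 →
    ValidFamily (n ∸ 1) m t A → DiamLe (n ∸ 1) A (n ∸ 1)
lemma4p3 m n m+3≤n _ t A t≤ (_ , subcubes) = DiamLe-resp (λ i → proj₁ (proj₂ (face i))) (diameter≤N small)
  where
  face : ∀ i → Σ (Face (n ∸ 1)) λ F → (∀ x → x ∈ᶠ F ⇔ A i x) × dim F ≤ proj₁ (subcubes i)
  face i = subcube⇒face (proj₂ (proj₂ (subcubes i)))
  F : Fin t → Face (n ∸ 1)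
  F i = proj₁ (face i)
  open Routing F
  small : ∀ i → t + 2 + dim (F i) ≤ n ∸ 1
  small i = ≤-trans (+-monoʳ-≤ (t + 2) (≤-trans (proj₂ (proj₂ (face i))) (proj₁ (proj₂ (subcubes i)))))
                    (t+2+m≤n∸1 m+3≤n t≤)
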